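{- Let $G$ be a graph, $S\subseteq V(G)$, $v\in V(G)$, and let $S'=(S\setminus\{v\})\cup N(v)$, where $N(v)$ is the set of neighbours of $v$. For any integer $q\ge 2$, $$\chi'_q(G,S)\ge \chi'_q(G-v,S')\ge \chi'_q(G,S)-q,$$ and in particular, if $\varepsilon>0$ and $\chi'_q(G,S)\ge q/\varepsilon$, then $\chi'_q(G-v,S')\ge(1-\varepsilon)\chi'_q(G,S)$.
   Context: Colours are non-negative integers; colour $0$ is special. For an edge colouring $f$ of $G$, write $f(u)=\{f(e): e\text{ incident with }u\}$. An edge $q$-colouring of $G$ is an edge colouring $f$ with $|f(u)|\le q$ for every vertex $u$. For $S\subseteq V(G)$, an edge $q$-colouring $f$ is $S$-composable if $|f(u)\setminus\{0\}|\le q-1$ for every $u\in S$. $\chi'_q(G,S)$ denotes the maximum number of non-zero colours used by an $S$-composable edge $q$-colouring of $G$. -}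

module Defs where

open import Data.Bool using (Bool; true; false; T; _∨_)
open import Data.Nat using (ℕ; suc; _≤_; _∸_)
open import Data.Nat.Properties using (_≟_)
open import Data.Fin using (Fin; punchIn)
open import Data.Fin.Subset using (Subset; _∈_)
open import Data.List using (List; map; filter; filterᵇ; concatMap; length; deduplicate; allFin)
open import Data.Vec using (tabulate; lookup)
open import Data.Product using (Σ; _×_; ∃)
open import Relation.Nullary using (¬?)
open import Relation.Binary.PropositionalEquality using (_≡_)
open import Data.Rational using (ℚ; 0ℚ; _<_; _÷_)
open import Data.Rational.Properties using (pos⇒nonZero)
import Data.Rational as ℚ
open import Data.Integer using (+_)

ℕ→ℚ : ℕ → ℚ
ℕ→ℚ m = + m ℚ./ 1

record Graph (n : ℕ) : Set where
  field
    adj    : Fin n → Fin n → Bool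
    sym    : ∀ u w → adj u w ≡ adj w u
    irrefl : ∀ u → adj u u ≡ false
open Graph public

_-v_ : ∀ {n} → Graph (suc n) → Fin (suc n) → Graph n
adj    (G -v v) i j = adj G (punchIn v i) (punchIn v j)
sym    (G -v v) i j = sym G (punchIn v i) (punchIn v j)
irrefl (G -v v) i   = irrefl G (punchIn v i)

-- An edge colouring: the colour of edge uw is f u w (values on non-adjacent
-- pairs are irrelevant); it must not depend on the orientation of the edge.
IsEdgeColouring : ∀ {n} → Graph n → (Fin n → Fin n → ℕ) → Set
IsEdgeColouring G f = ∀ u w → T (adj G u w) → f u w ≡ f w u

nbrs : ∀ {n} → Graph n → Fin n → List (Fin n)
nbrs {n} G u = filterᵇ (adj G u) (allFin n)

colsAt : ∀ {n} → Graph n → (Fin n → Fin n → ℕ) → Fin n → List ℕ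
colsAt G f u = deduplicate _≟_ (map (f u) (nbrs G u))

nzColsAt : ∀ {n} → Graph n → (Fin n → Fin n → ℕ) → Fin n → List ℕ
nzColsAt G f u = filter (λ c → ¬? (c ≟ 0)) (colsAt G f u)

usedNZColours : ∀ {n} → Graph n → (Fin n → Fin n → ℕ) → List ℕ
usedNZColours {n} G f =
  deduplicate _≟_ (filter (λ c → ¬? (c ≟ 0))
    (concatMap (λ u → map (f u) (nbrs G u)) (allFin n)))

IsEdgeQColouring : ∀ {n} → Graph n → ℕ → (Fin n → Fin n → ℕ) → Set
IsEdgeQColouring G q f = IsEdgeColouring G f × (∀ u → length (colsAt G f u) ≤ q)

IsSComposable : ∀ {n} → Graph n → Subset n → ℕ → (Fin n → Fin n → ℕ) → Set
IsSComposable G S q f =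
  IsEdgeQColouring G q f × (∀ u → u ∈ S → length (nzColsAt G f u) ≤ q ∸ 1)

Achieves : ∀ {n} → Graph n → Subset n → ℕ → ℕ → Set
Achieves {n} G S q k =
  Σ (Fin n → Fin n → ℕ) λ f → IsSComposable G S q f × length (usedNZColours G f) ≡ k

IsChi : ∀ {n} → Graph n → Subset n → ℕ → ℕ → Set
IsChi G S q m = Achieves G S q m × (∀ k → Achieves G S q k → k ≤ m)

S′ : ∀ {n} → Graph (suc n) → Subset (suc n) → Fin (suc n) → Subset n
S′ G S v = tabulate (λ i → lookup S (punchIn v i) ∨ adj G v (punchIn v i))

_÷pos_ : ℕ → (ε : ℚ) → {0ℚ < ε} → ℚ
(q ÷pos ε) {p} = (ℕ→ℚ q ÷ ε) {{pos⇒nonZero ε {{ℚ.positive p}}}}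

module Submission where

-- Extending a colouring of G − v by colour 0 on the edges at v keeps it S-composable: a
-- neighbour of v lies in S′, so it had at most q − 1 non-zero colours and 0 still fits.
-- Conversely, recolouring to 0 every edge of G − v whose colour occurs at v gives an
-- S′-composable colouring of G − v: a neighbour u of v already saw the colour of uv, which
-- becomes 0, so u keeps at most q − 1 non-zero colours; and only the at most q colours at v
-- are lost.

open import Defs hiding (sym)
open import Data.Bool using (T; T?; _∨_)
open import Data.Bool.Properties using (T-∨; T-≡)
open import Data.Nat using (ℕ; suc; _≤_; _+_; z≤n; s≤s; s≤s⁻¹; _≟_)
open import Data.Nat.Properties using (≤-trans; +-mono-≤; module ≤-Reasoning)
import Data.Nat.Coprimality as Coprime
open import Data.Empty using (⊥-elim)
open import Data.Fin as Fin using (Fin; punchIn; punchOut)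
import Data.Fin.Properties as Fin
open import Data.Fin.Subset using (Subset) renaming (_∈_ to _∈ₛ_)
open import Data.Integer as ℤ using (+_)
import Data.Integer.Properties as ℤ
open import Data.List using (List; []; _∷_; [_]; length; map; _++_; allFin)
open import Data.List.Properties using (length-map; length-++; length-removeAt′)
open import Data.List.Membership.Propositional using (_∈_; _∉_; _─_)
open import Data.List.Membership.Propositional.Properties
open import Data.List.Membership.DecPropositional _≟_ using (_∈?_)
open import Data.List.Relation.Binary.Subset.Propositional using (_⊆_)
import Data.List.Relation.Unary.All as All
open import Data.List.Relation.Unary.AllPairs using (_∷_)
open import Data.List.Relation.Unary.Any as Any using (here; there; index)
open import Data.List.Relation.Unary.Unique.Propositional using (Unique)
open import Data.List.Relation.Unary.Unique.DecPropositional.Properties _≟_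
  using (deduplicate-!; filter⁺)
open import Data.Product using (∃; _,_; proj₁; proj₂; _×_)
open import Data.Rational as ℚ using (ℚ; mkℚ; 0ℚ; 1ℚ; _<_; _-_; _*_; _÷_; *≤*)
import Data.Rational.Properties as ℚ
open import Data.Rational.Solver using (module +-*-Solver)
open import Data.Sum using (_⊎_; inj₁; inj₂; map₁)
open import Data.Vec using (lookup)
open import Data.Vec.Properties using (lookup∘tabulate; []=⇒lookup; lookup⇒[]=)
open import Function using (_∘_)
open import Function.Bundles using (Equivalence)
open import Relation.Nullary using (¬_; Dec; yes; no; ¬?)
open import Relation.Binary.PropositionalEquality
  using (_≡_; _≢_; refl; sym; trans; cong; cong₂; subst; module ≡-Reasoning)

open Equivalence using (to; from)

module _ {A : Set} where

  ∈-─ : ∀ {x y : A} {ys} (x∈ys : x ∈ ys) → y ∈ ys → x ≢ y → y ∈ ys ─ x∈ys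
  ∈-─ (here refl)  (here refl)  x≢y = ⊥-elim (x≢y refl)
  ∈-─ (here _)     (there y∈ys) _   = y∈ys
  ∈-─ (there _)    (here refl)  _   = here refl
  ∈-─ (there x∈ys) (there y∈ys) x≢y = there (∈-─ x∈ys y∈ys x≢y)

  Unique-⊆⇒length≤ : ∀ {xs ys : List A} → Unique xs → xs ⊆ ys → length xs ≤ length ys
  Unique-⊆⇒length≤ {[]}          _            _     = z≤n
  Unique-⊆⇒length≤ {x ∷ xs} {ys} (x≢xs ∷ xs!) xs⊆ys = begin
    suc (length xs)          ≤⟨ s≤s (Unique-⊆⇒length≤ xs! xs⊆ys─x) ⟩
    suc (length (ys ─ x∈ys)) ≡⟨ length-removeAt′ ys (index x∈ys) ⟨
    length ys                ∎
    where
    open ≤-Reasoning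
    x∈ys : x ∈ ys
    x∈ys = xs⊆ys (here refl)
    xs⊆ys─x : xs ⊆ ys ─ x∈ys
    xs⊆ys─x y∈xs = ∈-─ x∈ys (xs⊆ys (there y∈xs)) (All.lookup x≢xs y∈xs)

≢0? : (c : ℕ) → Dec (c ≢ 0)
≢0? c = ¬? (c ≟ 0)

adj-sym : ∀ {n} (G : Graph n) {u w} → T (adj G u w) → T (adj G w u)
adj-sym G {u} {w} = subst T (Graph.sym G u w)

module _ {n} (G : Graph n) (f : Fin n → Fin n → ℕ) where

  ∈-nbrs⁺ : ∀ {u w} → T (adj G u w) → w ∈ nbrs G u
  ∈-nbrs⁺ {u} {w} uw = ∈-filter⁺ (T? ∘ adj G u) (∈-allFin w) uw

  ∈-nbrs⁻ : ∀ {u w} → w ∈ nbrs G u → T (adj G u w)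
  ∈-nbrs⁻ {u} w∈ = proj₂ (∈-filter⁻ (T? ∘ adj G u) {xs = allFin n} w∈)

  ∈-colsAt⁺ : ∀ {u w} → T (adj G u w) → f u w ∈ colsAt G f u
  ∈-colsAt⁺ {u} uw = ∈-deduplicate⁺ _≟_ (∈-map⁺ (f u) (∈-nbrs⁺ uw))

  ∈-colsAt⁻ : ∀ {u c} → c ∈ colsAt G f u → ∃ λ w → T (adj G u w) × c ≡ f u w
  ∈-colsAt⁻ {u} c∈ with ∈-map⁻ (f u) (∈-deduplicate⁻ _≟_ (map (f u) (nbrs G u)) c∈)
  ... | w , w∈ , c≡ = w , ∈-nbrs⁻ w∈ , c≡

  ∈-nzColsAt⁺ : ∀ {u c} → c ∈ colsAt G f u → c ≢ 0 → c ∈ nzColsAt G f u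
  ∈-nzColsAt⁺ = ∈-filter⁺ ≢0?

  ∈-nzColsAt⁻ : ∀ {u c} → c ∈ nzColsAt G f u → c ∈ colsAt G f u × c ≢ 0
  ∈-nzColsAt⁻ = ∈-filter⁻ ≢0?

  ∈-usedNZColours⁺ : ∀ {u w} → T (adj G u w) → f u w ≢ 0 → f u w ∈ usedNZColours G f
  ∈-usedNZColours⁺ {u} uw ≢0 =
    ∈-deduplicate⁺ _≟_ (∈-filter⁺ ≢0?
      (∈-concatMap⁺ (λ x → map (f x) (nbrs G x))
        (Any.map (λ { refl → ∈-map⁺ (f u) (∈-nbrs⁺ uw) }) (∈-allFin u))) ≢0)

  ∈-usedNZColours⁻ : ∀ {c} → c ∈ usedNZColours G f →
                     c ≢ 0 × ∃ λ u → ∃ λ w → T (adj G u w) × c ≡ f u w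
  ∈-usedNZColours⁻ c∈ with c∈all , c≢0 ← ∈-filter⁻ ≢0? (∈-deduplicate⁻ _≟_ _ c∈)
    with u , c∈u ← Any.satisfied
                     (∈-concatMap⁻ (λ x → map (f x) (nbrs G x)) {xs = allFin n} c∈all)
    with w , w∈ , c≡ ← ∈-map⁻ (f u) c∈u
    = c≢0 , u , w , ∈-nbrs⁻ w∈ , c≡

  nzColsAt-Unique : ∀ u → Unique (nzColsAt G f u)
  nzColsAt-Unique u = filter⁺ ≢0? {xs = colsAt G f u} (deduplicate-! _)

  length-colsAt≤ : ∀ {u ys} → colsAt G f u ⊆ ys → length (colsAt G f u) ≤ length ys
  length-colsAt≤ = Unique-⊆⇒length≤ (deduplicate-! _)

  length-nzColsAt≤ : ∀ {u ys} → nzColsAt G f u ⊆ ys → length (nzColsAt G f u) ≤ length ys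
  length-nzColsAt≤ {u} = Unique-⊆⇒length≤ (nzColsAt-Unique u)

  length-0∷nzColsAt≤ : ∀ {u ys} → 0 ∷ nzColsAt G f u ⊆ ys →
                       suc (length (nzColsAt G f u)) ≤ length ys
  length-0∷nzColsAt≤ {u} = Unique-⊆⇒length≤
    (All.tabulate (λ c∈ 0≡c → proj₂ (∈-nzColsAt⁻ c∈) (sym 0≡c)) ∷ nzColsAt-Unique u)

  length-usedNZColours≤ : ∀ {ys} → usedNZColours G f ⊆ ys →
                          length (usedNZColours G f) ≤ length ys
  length-usedNZColours≤ = Unique-⊆⇒length≤ (deduplicate-! _)

data PunchView {n} (v : Fin (suc n)) : Fin (suc n) → Set where
  at-v    : PunchView v v
  punched : (i : Fin n) → PunchView v (punchIn v i)

punchView : ∀ {n} (v u : Fin (suc n)) → PunchView v u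
punchView v u with v Fin.≟ u
... | yes refl = at-v
... | no v≢u   = subst (PunchView v) (Fin.punchIn-punchOut v≢u) (punched (punchOut v≢u))

punchOut-punchIn′ : ∀ {n} (v : Fin (suc n)) {i} (v≢i : v ≢ punchIn v i) → punchOut v≢i ≡ i
punchOut-punchIn′ v v≢i = trans (Fin.punchOut-cong v refl) (Fin.punchOut-punchIn v)

module _ {n} (G : Graph (suc n)) (S : Subset (suc n)) (v : Fin (suc n)) {i : Fin n} where

  private
    lookup-S′ : lookup (S′ G S v) i ≡ lookup S (punchIn v i) ∨ adj G v (punchIn v i)
    lookup-S′ = lookup∘tabulate _ i

  ∈-S′⁻ : i ∈ₛ S′ G S v → punchIn v i ∈ₛ S ⊎ T (adj G v (punchIn v i))
  ∈-S′⁻ i∈S′ = map₁ (lookup⇒[]= _ S ∘ to T-≡)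
    (to T-∨ (from T-≡ (trans (sym lookup-S′) ([]=⇒lookup i∈S′))))

  ∈-S′⁺ : punchIn v i ∈ₛ S ⊎ T (adj G v (punchIn v i)) → i ∈ₛ S′ G S v
  ∈-S′⁺ h = lookup⇒[]= i _
    (trans lookup-S′ (to T-≡ (from T-∨ (map₁ (from T-≡ ∘ []=⇒lookup) h))))

module _ {n} (v : Fin (suc n)) (f′ : Fin n → Fin n → ℕ) where

  extend₀ : Fin (suc n) → Fin (suc n) → ℕ
  extend₀ u w with v Fin.≟ u | v Fin.≟ w
  ... | no v≢u | no v≢w = f′ (punchOut v≢u) (punchOut v≢w)
  ... | _      | _      = 0

  extend₀-from-v : ∀ w → extend₀ v w ≡ 0
  extend₀-from-v w with v Fin.≟ v | v Fin.≟ w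
  ... | yes _  | _ = refl
  ... | no v≢v | _ = ⊥-elim (v≢v refl)

  extend₀-to-v : ∀ u → extend₀ u v ≡ 0
  extend₀-to-v u with v Fin.≟ u | v Fin.≟ v
  ... | yes _ | _      = refl
  ... | no _  | yes _  = refl
  ... | no _  | no v≢v = ⊥-elim (v≢v refl)

  extend₀-punchIn : ∀ i j → extend₀ (punchIn v i) (punchIn v j) ≡ f′ i j
  extend₀-punchIn i j with v Fin.≟ punchIn v i | v Fin.≟ punchIn v j
  ... | yes v≡i | _       = ⊥-elim (Fin.punchInᵢ≢i v i (sym v≡i))
  ... | no _    | yes v≡j = ⊥-elim (Fin.punchInᵢ≢i v j (sym v≡j))
  ... | no v≢i  | no v≢j  = cong₂ f′ (punchOut-punchIn′ v v≢i) (punchOut-punchIn′ v v≢j)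

module _ {n} (G : Graph (suc n)) (v : Fin (suc n)) (f′ : Fin n → Fin n → ℕ) where

  private
    G′ = G -v v
    F  = extend₀ v f′

  extend₀-isEdgeColouring : IsEdgeColouring G′ f′ → IsEdgeColouring G F
  extend₀-isEdgeColouring col′ u w uw with punchView v u | punchView v w
  ... | at-v      | _         = trans (extend₀-from-v v f′ w) (sym (extend₀-to-v v f′ w))
  ... | punched i | at-v      = trans (extend₀-to-v v f′ _) (sym (extend₀-from-v v f′ _))
  ... | punched i | punched j = begin
    F (punchIn v i) (punchIn v j) ≡⟨ extend₀-punchIn v f′ i j ⟩
    f′ i j                        ≡⟨ col′ i j uw ⟩
    f′ j i                        ≡⟨ extend₀-punchIn v f′ j i ⟨
    F (punchIn v j) (punchIn v i) ∎
    where open ≡-Reasoning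

  colsAt-extend₀-v : colsAt G F v ⊆ [ 0 ]
  colsAt-extend₀-v c∈ with w , _ , c≡ ← ∈-colsAt⁻ G F c∈ =
    here (trans c≡ (extend₀-from-v v f′ w))

  nzColsAt-extend₀-v : nzColsAt G F v ⊆ []
  nzColsAt-extend₀-v c∈ with c∈cols , c≢0 ← ∈-nzColsAt⁻ G F c∈
    with here c≡0 ← colsAt-extend₀-v c∈cols = ⊥-elim (c≢0 c≡0)

  ∈-colsAt-extend₀-punchIn : ∀ i {c} → c ∈ colsAt G F (punchIn v i) →
                             c ≡ 0 × T (adj G v (punchIn v i)) ⊎ c ∈ colsAt G′ f′ i
  ∈-colsAt-extend₀-punchIn i c∈ with w , iw , c≡ ← ∈-colsAt⁻ G F c∈ with punchView v w
  ... | at-v      = inj₁ (trans c≡ (extend₀-to-v v f′ _) , adj-sym G iw)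
  ... | punched j = inj₂ (subst (_∈ colsAt G′ f′ i) (sym (trans c≡ (extend₀-punchIn v f′ i j)))
                                (∈-colsAt⁺ G′ f′ iw))

  colsAt-extend₀-punchIn : ∀ i → colsAt G F (punchIn v i) ⊆ 0 ∷ nzColsAt G′ f′ i
  colsAt-extend₀-punchIn i {c} c∈ with c ≟ 0 | ∈-colsAt-extend₀-punchIn i c∈
  ... | yes c≡0 | _              = here c≡0
  ... | no c≢0  | inj₁ (c≡0 , _) = ⊥-elim (c≢0 c≡0)
  ... | no c≢0  | inj₂ c∈′       = there (∈-nzColsAt⁺ G′ f′ c∈′ c≢0)

  colsAt-extend₀-punchIn-¬adj : ∀ i → ¬ T (adj G v (punchIn v i)) →
                                colsAt G F (punchIn v i) ⊆ colsAt G′ f′ i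
  colsAt-extend₀-punchIn-¬adj i ¬vi c∈ with ∈-colsAt-extend₀-punchIn i c∈
  ... | inj₁ (_ , vi) = ⊥-elim (¬vi vi)
  ... | inj₂ c∈′      = c∈′

  nzColsAt-extend₀-punchIn : ∀ i → nzColsAt G F (punchIn v i) ⊆ nzColsAt G′ f′ i
  nzColsAt-extend₀-punchIn i c∈ with c∈cols , c≢0 ← ∈-nzColsAt⁻ G F c∈
    with colsAt-extend₀-punchIn i c∈cols
  ... | here c≡0  = ⊥-elim (c≢0 c≡0)
  ... | there c∈′ = c∈′

  extend₀-isSComposable : ∀ {S q} → IsSComposable G′ (S′ G S v) (suc q) f′ →
                          IsSComposable G S (suc q) F
  extend₀-isSComposable {S} {q} ((col′ , ≤q′) , nz≤q′) =
    (extend₀-isEdgeColouring col′ , ≤q) , nz≤q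
    where
    ≤q : ∀ u → length (colsAt G F u) ≤ suc q
    ≤q u with punchView v u
    ... | at-v = ≤-trans (length-colsAt≤ G F colsAt-extend₀-v) (s≤s z≤n)
    ... | punched i with T? (adj G v (punchIn v i))
    ...   | yes vi = ≤-trans (length-colsAt≤ G F (colsAt-extend₀-punchIn i))
                             (s≤s (nz≤q′ i (∈-S′⁺ G S v (inj₂ vi))))
    ...   | no ¬vi = ≤-trans (length-colsAt≤ G F (colsAt-extend₀-punchIn-¬adj i ¬vi)) (≤q′ i)

    nz≤q : ∀ u → u ∈ₛ S → length (nzColsAt G F u) ≤ q
    nz≤q u u∈S with punchView v u
    ... | at-v      = ≤-trans (length-nzColsAt≤ G F nzColsAt-extend₀-v) z≤n
    ... | punched i = ≤-trans (length-nzColsAt≤ G F (nzColsAt-extend₀-punchIn i))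
                              (nz≤q′ i (∈-S′⁺ G S v (inj₁ u∈S)))

  usedNZColours-extend₀ : usedNZColours G′ f′ ⊆ usedNZColours G F
  usedNZColours-extend₀ c∈ with c≢0 , i , j , ij , c≡ ← ∈-usedNZColours⁻ G′ f′ c∈ =
    subst (_∈ usedNZColours G F) F≡c (∈-usedNZColours⁺ G F ij (c≢0 ∘ trans (sym F≡c)))
    where
    F≡c : F (punchIn v i) (punchIn v j) ≡ _
    F≡c = trans (extend₀-punchIn v f′ i j) (sym c≡)

zeroOn : List ℕ → ℕ → ℕ
zeroOn C c with c ∈? C
... | yes _ = 0
... | no _  = c

zeroOn-∈ : ∀ {C c} → c ∈ C → zeroOn C c ≡ 0
zeroOn-∈ {C} {c} c∈C with c ∈? C
... | yes _  = refl
... | no c∉C = ⊥-elim (c∉C c∈C)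

zeroOn-∉ : ∀ {C c} → c ∉ C → zeroOn C c ≡ c
zeroOn-∉ {C} {c} c∉C with c ∈? C
... | yes c∈C = ⊥-elim (c∉C c∈C)
... | no _    = refl

zeroOn-≢0 : ∀ {C c} → zeroOn C c ≢ 0 → zeroOn C c ≡ c
zeroOn-≢0 {C} {c} ≢0 with c ∈? C
... | yes _ = ⊥-elim (≢0 refl)
... | no _  = refl

module _ {n} (G : Graph (suc n)) (v : Fin (suc n)) (f : Fin (suc n) → Fin (suc n) → ℕ) where

  private
    G′ = G -v v
    C  = colsAt G f v

  restrict : Fin n → Fin n → ℕ
  restrict i j = zeroOn C (f (punchIn v i) (punchIn v j))

  restrict-isEdgeColouring : IsEdgeColouring G f → IsEdgeColouring G′ restrict
  restrict-isEdgeColouring col i j ij = cong (zeroOn C) (col _ _ ij)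

  colsAt-restrict : ∀ i → colsAt G′ restrict i ⊆ map (zeroOn C) (colsAt G f (punchIn v i))
  colsAt-restrict i c∈ with j , ij , c≡ ← ∈-colsAt⁻ G′ restrict c∈ =
    subst (_∈ _) (sym c≡) (∈-map⁺ (zeroOn C) (∈-colsAt⁺ G f ij))

  nzColsAt-restrict : ∀ i → nzColsAt G′ restrict i ⊆ nzColsAt G f (punchIn v i)
  nzColsAt-restrict i c∈ with c∈cols , c≢0 ← ∈-nzColsAt⁻ G′ restrict c∈
    with x , x∈ , c≡ ← ∈-map⁻ (zeroOn C) (colsAt-restrict i c∈cols) =
    ∈-nzColsAt⁺ G f (subst (_∈ _) (sym (trans c≡ (zeroOn-≢0 (c≢0 ∘ trans c≡)))) x∈) c≢0

  -- The edge from v to i has a colour of C, which becomes 0.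
  0∷nzColsAt-restrict : IsEdgeColouring G f → ∀ i → T (adj G v (punchIn v i)) →
                        0 ∷ nzColsAt G′ restrict i ⊆ map (zeroOn C) (colsAt G f (punchIn v i))
  0∷nzColsAt-restrict col i vi (here refl) =
    subst (_∈ map (zeroOn C) (colsAt G f (punchIn v i)))
      (zeroOn-∈ (subst (_∈ C) (col v _ vi) (∈-colsAt⁺ G f vi)))
      (∈-map⁺ (zeroOn C) (∈-colsAt⁺ G f (adj-sym G vi)))
  0∷nzColsAt-restrict col i vi (there c∈) =
    colsAt-restrict i (proj₁ (∈-nzColsAt⁻ G′ restrict c∈))

  restrict-isSComposable : ∀ {S q} → IsSComposable G S (suc q) f →
                           IsSComposable G′ (S′ G S v) (suc q) restrict
  restrict-isSComposable {S} {q} ((col , ≤q) , nz≤q) =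
    (restrict-isEdgeColouring col , ≤q′) , nz≤q′
    where
    length-map-colsAt≤ : ∀ i → length (map (zeroOn C) (colsAt G f (punchIn v i))) ≤ suc q
    length-map-colsAt≤ i =
      subst (_≤ suc q) (sym (length-map (zeroOn C) (colsAt G f (punchIn v i)))) (≤q (punchIn v i))

    ≤q′ : ∀ i → length (colsAt G′ restrict i) ≤ suc q
    ≤q′ i = ≤-trans (length-colsAt≤ G′ restrict (colsAt-restrict i)) (length-map-colsAt≤ i)

    nz≤q′ : ∀ i → i ∈ₛ S′ G S v → length (nzColsAt G′ restrict i) ≤ q
    nz≤q′ i i∈S′ with ∈-S′⁻ G S v i∈S′
    ... | inj₁ i∈S = ≤-trans (length-nzColsAt≤ G′ restrict (nzColsAt-restrict i)) (nz≤q _ i∈S)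
    ... | inj₂ vi  = s≤s⁻¹ (≤-trans (length-0∷nzColsAt≤ G′ restrict (0∷nzColsAt-restrict col i vi))
                                    (length-map-colsAt≤ i))

  usedNZColours-restrict : IsEdgeColouring G f →
                           usedNZColours G f ⊆ usedNZColours G′ restrict ++ C
  usedNZColours-restrict col {c} c∈ with c ∈? C
  ... | yes c∈C = ∈-++⁺ʳ _ c∈C
  ... | no c∉C with c≢0 , u , w , uw , c≡ ← ∈-usedNZColours⁻ G f c∈
    with punchView v u | punchView v w
  ...   | at-v      | _         = ⊥-elim (c∉C (subst (_∈ C) (sym c≡) (∈-colsAt⁺ G f uw)))
  ...   | punched i | at-v      = ⊥-elim (c∉C (subst (_∈ C) (trans (col v _ wu) (sym c≡))
                                                     (∈-colsAt⁺ G f wu)))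
    where
    wu = adj-sym G uw
  ...   | punched i | punched j =
    ∈-++⁺ˡ (subst (_∈ _) restrict≡c
             (∈-usedNZColours⁺ G′ restrict uw (c≢0 ∘ trans (sym restrict≡c))))
    where
    restrict≡c : restrict i j ≡ c
    restrict≡c = trans (zeroOn-∉ (c∉C ∘ subst (_∈ C) (sym c≡))) (sym c≡)

module _ {n} (G : Graph (suc n)) (S : Subset (suc n)) (v : Fin (suc n)) {q : ℕ} where

  χ′-deleteVertex≤χ′ : ∀ {m k} → IsChi G S (suc q) m →
                       Achieves (G -v v) (S′ G S v) (suc q) k → k ≤ m
  χ′-deleteVertex≤χ′ (_ , maximal) (f′ , f′-composable , refl) =
    ≤-trans (length-usedNZColours≤ (G -v v) f′ (usedNZColours-extend₀ G v f′))
            (maximal _ (extend₀ v f′ , extend₀-isSComposable G v f′ f′-composable , refl))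

  χ′≤χ′-deleteVertex+q : ∀ {m′ k} → IsChi (G -v v) (S′ G S v) (suc q) m′ →
                         Achieves G S (suc q) k → k ≤ m′ + suc q
  χ′≤χ′-deleteVertex+q {m′} (_ , maximal′) (f , f-composable@((col , ≤q) , _) , refl) = begin
    length (usedNZColours G f)
      ≤⟨ length-usedNZColours≤ G f (usedNZColours-restrict G v f col) ⟩
    length (usedNZColours (G -v v) f′ ++ colsAt G f v)
      ≡⟨ length-++ (usedNZColours (G -v v) f′) ⟩
    length (usedNZColours (G -v v) f′) + length (colsAt G f v)
      ≤⟨ +-mono-≤ (maximal′ _ (f′ , restrict-isSComposable G v f f-composable , refl)) (≤q v) ⟩
    m′ + suc q
      ∎
    where
    open ≤-Reasoning
    f′ = restrict G v f

ℕ→ℚ≡mkℚ : ∀ a → ℕ→ℚ a ≡ mkℚ (+ a) 0 (Coprime.sym (Coprime.1-coprimeTo a))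
ℕ→ℚ≡mkℚ a = ℚ.normalize-coprime (Coprime.sym (Coprime.1-coprimeTo a))

ℕ→ℚ-mono-≤ : ∀ {a b} → a ≤ b → ℕ→ℚ a ℚ.≤ ℕ→ℚ b
ℕ→ℚ-mono-≤ {a} {b} a≤b rewrite ℕ→ℚ≡mkℚ a | ℕ→ℚ≡mkℚ b =
  *≤* (ℤ.*-monoʳ-≤-nonNeg (+ 1) (ℤ.+≤+ a≤b))

ℕ→ℚ-homo-+ : ∀ a b → ℕ→ℚ (a + b) ≡ ℕ→ℚ a ℚ.+ ℕ→ℚ b
ℕ→ℚ-homo-+ a b rewrite ℕ→ℚ≡mkℚ a | ℕ→ℚ≡mkℚ b =
  ℚ./-cong (sym (cong₂ ℤ._+_ (ℤ.*-identityʳ (+ a)) (ℤ.*-identityʳ (+ b)))) refl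

÷-≤⇒≤-* : ∀ p q r .{{_ : ℚ.Positive r}} → (p ÷ r) {{ℚ.pos⇒nonZero r}} ℚ.≤ q → p ℚ.≤ q * r
÷-≤⇒≤-* p q r p÷r≤q = begin
  p                 ≡⟨ ℚ.*-identityʳ p ⟨
  p * 1ℚ            ≡⟨ cong (p *_) (ℚ.*-inverseˡ r) ⟨
  p * (ℚ.1/ r * r)  ≡⟨ ℚ.*-assoc p (ℚ.1/ r) r ⟨
  p ÷ r * r         ≤⟨ ℚ.*-monoʳ-≤-nonNeg r {{ℚ.pos⇒nonNeg r}} p÷r≤q ⟩
  q * r             ∎
  where
  open ℚ.≤-Reasoning
  instance
    r≢0 : ℚ.NonZero r
    r≢0 = ℚ.pos⇒nonZero r

absoluteLoss⇒relativeLoss : ∀ {ε m m′ q} → q ℚ.≤ m * ε → m ℚ.≤ m′ ℚ.+ q →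
                            (1ℚ - ε) * m ℚ.≤ m′
absoluteLoss⇒relativeLoss {ε} {m} {m′} {q} q≤mε m≤m′+q = begin
  (1ℚ - ε) * m    ≡⟨ solve 2 (λ ε m → (con 1ℚ :- ε) :* m := m :- m :* ε) refl ε m ⟩
  m - m * ε       ≤⟨ ℚ.+-monoʳ-≤ m (ℚ.neg-antimono-≤ q≤mε) ⟩
  m - q           ≤⟨ ℚ.+-monoˡ-≤ (ℚ.- q) m≤m′+q ⟩
  (m′ ℚ.+ q) - q  ≡⟨ solve 2 (λ m′ q → (m′ :+ q) :- q := m′) refl m′ q ⟩
  m′              ∎
  where
  open ℚ.≤-Reasoning
  open +-*-Solver

lemma2 : ∀ {n} (G : Graph (suc n)) (S : Subset (suc n)) (v : Fin (suc n)) (q : ℕ) → 2 ≤ q →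
    (m m′ : ℕ) → IsChi G S q m → IsChi (G -v v) (S′ G S v) q m′ →
    (m′ ≤ m × m ≤ m′ + q) ×
    ((ε : ℚ) (ε>0 : 0ℚ < ε) → (q ÷pos ε) {ε>0} ℚ.≤ ℕ→ℚ m →
      (1ℚ - ε) * ℕ→ℚ m ℚ.≤ ℕ→ℚ m′)
lemma2 G S v (suc q) _ m m′ χ χ′ = (m′≤m , m≤m′+q) , relative
  where
  m′≤m : m′ ≤ m
  m′≤m = χ′-deleteVertex≤χ′ G S v χ (proj₁ χ′)

  m≤m′+q : m ≤ m′ + suc q
  m≤m′+q = χ′≤χ′-deleteVertex+q G S v χ′ (proj₁ χ)

  relative : (ε : ℚ) (ε>0 : 0ℚ < ε) → (suc q ÷pos ε) {ε>0} ℚ.≤ ℕ→ℚ m →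
             (1ℚ - ε) * ℕ→ℚ m ℚ.≤ ℕ→ℚ m′
  relative ε ε>0 q/ε≤m = absoluteLoss⇒relativeLoss
    (÷-≤⇒≤-* (ℕ→ℚ (suc q)) (ℕ→ℚ m) ε {{ℚ.positive ε>0}} q/ε≤m)
    (subst (ℕ→ℚ m ℚ.≤_) (ℕ→ℚ-homo-+ m′ (suc q)) (ℕ→ℚ-mono-≤ m≤m′+q))
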